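{- Let $m,n,k\in\mathbb{N}$ with $k\geq 3$. Then (a) $\chi(C_k^{\frac{m}{n}})=nk$ if $m\geq \frac{nk}{2}$, and $\chi(C_k^{\frac{m}{n}})=\left\lceil\frac{nk}{\lfloor nk/(m+1)\rfloor}\right\rceil$ if $m<\frac{nk}{2}$; (b) $\chi(P_k^{\frac{m}{n}})=\min\{m+1,(k-1)n+1\}$.
   Context: $C_k$ denotes the cycle on $k$ vertices and $P_k$ the path on $k$ vertices. For a graph $H$ and $m\in\mathbb{N}$, the $m$-power $H^m$ has vertex set $V(H)$, with distinct vertices $x,y$ adjacent iff $1\le d_H(x,y)\le m$. For $n\in\mathbb{N}$, the $n$-subdivision $G^{\frac1n}$ is obtained from $G$ by replacing each edge by a path of length $n$. The fractional power $G^{\frac{m}{n}}$ is $(G^{\frac1n})^m$. $\chi$ denotes the chromatic number. -}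

module Defs where

open import Data.Nat using (ℕ; zero; suc; _+_; _∸_; _≤_; _<_; _*_)
open import Data.Nat.DivMod using (_/_)
open import Data.Fin using (Fin; zero; suc; inject₁)
open import Data.Maybe using (Maybe; just; nothing; maybe)
import Data.Maybe as Maybe
open import Data.Product using (Σ; _×_; _,_; ∃)
open import Data.Sum using (_⊎_; inj₁; inj₂)
open import Relation.Binary.PropositionalEquality using (_≡_; _≢_)

record Graph : Set₁ where
  field
    V    : Set
    Edge : Set
    src  : Edge → V
    tgt  : Edge → V
open Graph public

Adj : (G : Graph) → V G → V G → Set
Adj G x y = Σ (Edge G) λ e → (src G e ≡ x × tgt G e ≡ y) ⊎ (src G e ≡ y × tgt G e ≡ x)

data Walk (G : Graph) : V G → V G → ℕ → Set where
  here : ∀ {x} → Walk G x x 0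
  step : ∀ {x y z ℓ} → Adj G x y → Walk G y z ℓ → Walk G x z (suc ℓ)

DistLe : (G : Graph) → V G → V G → ℕ → Set
DistLe G x y m = Σ ℕ λ ℓ → ℓ ≤ m × Walk G x y ℓ

PowAdj : (G : Graph) → ℕ → V G → V G → Set
PowAdj G m x y = x ≢ y × DistLe G x y m

power : Graph → ℕ → Graph
power G m = record
  { V    = V G
  ; Edge = Σ (V G) λ x → Σ (V G) λ y → PowAdj G m x y
  ; src  = λ { (x , _ , _) → x }
  ; tgt  = λ { (_ , y , _) → y }
  }

-- last? i = nothing iff i is the largest element of Fin (suc n);
-- otherwise just (the same number, viewed in Fin n).
last? : ∀ {n} → Fin (suc n) → Maybe (Fin n)
last? {zero}  zero    = nothing
last? {suc n} zero    = just zero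
last? {suc n} (suc i) = Maybe.map suc (last? i)

-- n-subdivision for n = suc n': each edge e becomes the path
-- src e = p₀, p₁, …, p_{n} = tgt e, with fresh internal vertices (e , 0..n'-1).
subdivision′ : Graph → ℕ → Graph
subdivision′ G n' = record
  { V    = V G ⊎ (Edge G × Fin n')
  ; Edge = Edge G × Fin (suc n')
  ; src  = λ { (e , j) → pt e (inject₁ j) }
  ; tgt  = λ { (e , j) → pt e (suc j) }
  }
  where
  pt : Edge G → Fin (suc (suc n')) → V G ⊎ (Edge G × Fin n')
  pt e zero    = inj₁ (src G e)
  pt e (suc i) = maybe (λ k → inj₂ (e , k)) (inj₁ (tgt G e)) (last? i)

-- G^{1/n}; the case n = 0 is meaningless and is never used (all statements assume n ≥ 1).
subdivision : Graph → ℕ → Graph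
subdivision G zero    = G
subdivision G (suc n') = subdivision′ G n'

fracPower : Graph → ℕ → ℕ → Graph
fracPower G m n = power (subdivision G n) m

cnext : ∀ {k} → Fin k → Fin k
cnext {suc k} i = maybe suc zero (last? i)

cycle : ℕ → Graph
cycle k = record { V = Fin k ; Edge = Fin k ; src = λ i → i ; tgt = cnext }

path : ℕ → Graph
path zero    = record { V = Fin zero ; Edge = Fin zero ; src = λ i → i ; tgt = λ i → i }
path (suc k) = record { V = Fin (suc k) ; Edge = Fin k ; src = inject₁ ; tgt = suc }

Colorable : Graph → ℕ → Set
Colorable G q = Σ (V G → Fin q) λ c → ∀ (e : Edge G) → c (src G e) ≢ c (tgt G e)

ChromaticNumber : Graph → ℕ → Set
ChromaticNumber G q = Colorable G q × (∀ r → Colorable G r → q ≤ r)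

ceilDiv : ℕ → ℕ → ℕ
ceilDiv a zero    = 0
ceilDiv a (suc b) = (a + b) / suc b

module Submission where

-- Number the vertices of C_k^{1/n} around the cycle by 0, …, nk − 1 and those of P_k^{1/n}
-- along the path by 0, …, (k − 1)n.  Two vertices are adjacent in the m-th power exactly when
-- their cyclic (resp. linear) distance is at most m, so a proper colouring of the power is a
-- colouring of ℤ/nk in which equal colours are more than m apart both ways round.
-- Such a colour class has at most t = ⌊nk/(m+1)⌋ elements, whence χ ≥ ⌈nk/t⌉; if nk ≤ 2m
-- any two vertices are adjacent and χ = nk.  Conversely, with q = ⌈nk/t⌉ one writes
-- nk = s q + e (q − 1) and colours s consecutive blocks of length q and then e blocks of
-- length q − 1 by the position inside the block; all blocks have length ≥ m + 1.
-- On the path, p ↦ p mod min(m + 1, (k − 1)n + 1) is proper and the first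
-- min(m + 1, (k − 1)n + 1) vertices form a clique.

open import Defs
open import Data.Nat
open import Data.Nat.Properties
open import Data.Nat.DivMod
open import Algebra.Properties.CommutativeSemigroup +-commutativeSemigroup using (x∙yz≈y∙xz)
open import Data.Nat.Tactic.RingSolver using (solve; solve-∀)
open import Data.Fin using (Fin; zero; suc; toℕ; inject₁; fromℕ<; combine)
import Data.Fin as Fin
open import Data.Fin.Properties using (toℕ<n; toℕ-injective; toℕ-fromℕ<; toℕ-inject₁; pigeonhole; combine-injective)
open import Data.Maybe using (just; nothing)
import Data.Maybe as Maybe
open import Data.Empty using (⊥-elim)
open import Data.Product using (_×_; _,_; proj₁; proj₂; ∃-syntax)
open import Data.Sum using (_⊎_; inj₁; inj₂)
open import Data.List using (_∷_; [])
open import Relation.Binary.PropositionalEquality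
open import Relation.Nullary using (yes; no)
open import Function using (_∘_)

-- b ≡ a + d (mod M) with the multiples of M made explicit; for M = 0 this is b ≡ a + d.
record Ahead (M a b d : ℕ) : Set where
  constructor ahead
  field
    laps laps′ : ℕ
    equation   : a + d + laps * M ≡ b + laps′ * M

Apart : ℕ → ℕ → ℕ → ℕ → Set
Apart M a b d = Ahead M a b d ⊎ Ahead M b a d

ahead-refl : ∀ M a → Ahead M a a 0
ahead-refl M a = ahead 0 0 (cong (_+ 0) (+-identityʳ a))

ahead-trans : ∀ {M a b c d e} → Ahead M a b d → Ahead M b c e → Ahead M a c (d + e)
ahead-trans {M} {a} {b} {c} {d} {e} (ahead j j′ p) (ahead i i′ q) = ahead (j + i) (i′ + j′) (begin
  a + (d + e) + (j + i) * M   ≡⟨ solve (a ∷ d ∷ e ∷ j ∷ i ∷ M ∷ []) ⟩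
  (a + d + j * M) + e + i * M ≡⟨ cong (λ u → u + e + i * M) p ⟩
  (b + j′ * M) + e + i * M    ≡⟨ solve (b ∷ j′ ∷ M ∷ e ∷ i ∷ []) ⟩
  (b + e + i * M) + j′ * M    ≡⟨ cong (_+ j′ * M) q ⟩
  c + i′ * M + j′ * M         ≡⟨ solve (c ∷ i′ ∷ j′ ∷ M ∷ []) ⟩
  c + (i′ + j′) * M           ∎)
  where open ≡-Reasoning

ahead₀-sym : ∀ {M a b} → Ahead M a b 0 → Ahead M b a 0
ahead₀-sym {M} {a} {b} (ahead j j′ p) = ahead j′ j (begin
  b + 0 + j′ * M ≡⟨ cong (_+ j′ * M) (+-identityʳ b) ⟩
  b + j′ * M     ≡⟨ sym p ⟩
  a + 0 + j * M  ≡⟨ cong (_+ j * M) (+-identityʳ a) ⟩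
  a + j * M      ∎)
  where open ≡-Reasoning

ahead-cancelˡ : ∀ {M a b c d} → Ahead M b a 1 → Ahead M b c (suc d) → Ahead M a c d
ahead-cancelˡ {M} {a} {b} {c} {d} (ahead j j′ p) (ahead i i′ q) = ahead (j′ + i) (i′ + j) (begin
  a + d + (j′ + i) * M        ≡⟨ solve (a ∷ d ∷ j′ ∷ i ∷ M ∷ []) ⟩
  (a + j′ * M) + d + i * M    ≡⟨ cong (λ u → u + d + i * M) (sym p) ⟩
  (b + 1 + j * M) + d + i * M ≡⟨ solve (b ∷ j ∷ M ∷ d ∷ i ∷ []) ⟩
  (b + suc d + i * M) + j * M ≡⟨ cong (_+ j * M) q ⟩
  c + i′ * M + j * M          ≡⟨ solve (c ∷ i′ ∷ j ∷ M ∷ []) ⟩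
  c + (i′ + j) * M            ∎)
  where open ≡-Reasoning

ahead-cancelʳ : ∀ {M a b c d} → Ahead M a b 1 → Ahead M c b (suc d) → Ahead M c a d
ahead-cancelʳ {M} {a} {b} {c} {d} (ahead j j′ p) (ahead i i′ q) = ahead (i + j′) (i′ + j)
  (+-cancelʳ-≡ 1 _ _ (begin
  c + d + (i + j′) * M + 1     ≡⟨ solve (c ∷ d ∷ i ∷ j′ ∷ M ∷ []) ⟩
  (c + suc d + i * M) + j′ * M ≡⟨ cong (_+ j′ * M) q ⟩
  b + i′ * M + j′ * M          ≡⟨ solve (b ∷ i′ ∷ j′ ∷ M ∷ []) ⟩
  (b + j′ * M) + i′ * M        ≡⟨ cong (_+ i′ * M) (sym p) ⟩
  a + 1 + j * M + i′ * M       ≡⟨ solve (a ∷ j ∷ i′ ∷ M ∷ []) ⟩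
  a + (i′ + j) * M + 1         ∎))
  where open ≡-Reasoning

apart-step : ∀ {M a b c d} → Apart M a b 1 → Apart M b c d → ∃[ d′ ] d′ ≤ suc d × Apart M a c d′
apart-step {d = d}     (inj₁ ab) (inj₁ bc) = suc d , ≤-refl , inj₁ (ahead-trans ab bc)
apart-step {d = zero}  (inj₁ ab) (inj₂ cb) = 1 , ≤-refl , inj₁ (ahead-trans ab (ahead₀-sym cb))
apart-step {d = suc d} (inj₁ ab) (inj₂ cb) = d , m≤n⇒m≤1+n (n≤1+n d) , inj₂ (ahead-cancelʳ ab cb)
apart-step {d = zero}  (inj₂ ba) (inj₁ bc) = 1 , ≤-refl , inj₂ (ahead-trans (ahead₀-sym bc) ba)
apart-step {d = suc d} (inj₂ ba) (inj₁ bc) = d , m≤n⇒m≤1+n (n≤1+n d) , inj₁ (ahead-cancelˡ ba bc)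
apart-step {d = d}     (inj₂ ba) (inj₂ cb) = d + 1 , ≤-reflexive (+-comm d 1) , inj₂ (ahead-trans cb ba)

module ApartAlongWalks (G : Graph) (M : ℕ) (pos : V G → ℕ)
  (edge-ahead : ∀ e → Ahead M (pos (src G e)) (pos (tgt G e)) 1) where

  adj⇒apart : ∀ {x y} → Adj G x y → Apart M (pos x) (pos y) 1
  adj⇒apart (e , inj₁ (refl , refl)) = inj₁ (edge-ahead e)
  adj⇒apart (e , inj₂ (refl , refl)) = inj₂ (edge-ahead e)

  walk⇒apart : ∀ {x y ℓ} → Walk G x y ℓ → ∃[ d ] d ≤ ℓ × Apart M (pos x) (pos y) d
  walk⇒apart {x} here = 0 , z≤n , inj₁ (ahead-refl M (pos x))
  walk⇒apart (step xy w) with walk⇒apart w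
  ... | d , d≤ℓ , yz with apart-step (adj⇒apart xy) yz
  ... | d′ , d′≤ , xz = d′ , ≤-trans d′≤ (s≤s d≤ℓ) , xz

fromℕ<-injective : ∀ {a b n} (a<n : a < n) (b<n : b < n) → fromℕ< a<n ≡ fromℕ< b<n → a ≡ b
fromℕ<-injective a<n b<n eq = trans (sym (toℕ-fromℕ< a<n)) (trans (cong toℕ eq) (toℕ-fromℕ< b<n))

same-residue⇒gap : ∀ q .{{_ : NonZero q}} {x y} → x < y → x % q ≡ y % q → x + q ≤ y
same-residue⇒gap q {x} {y} x<y eq with x / q <? y / q
... | yes lt = begin
  x + q                     ≡⟨ cong (_+ q) (m≡m%n+[m/n]*n x q) ⟩
  x % q + (x / q) * q + q   ≡⟨ +-assoc (x % q) _ q ⟩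
  x % q + ((x / q) * q + q) ≡⟨ cong (x % q +_) (+-comm ((x / q) * q) q) ⟩
  x % q + suc (x / q) * q   ≤⟨ +-mono-≤ (≤-reflexive eq) (*-monoˡ-≤ q lt) ⟩
  y % q + (y / q) * q       ≡⟨ m≡m%n+[m/n]*n y q ⟨
  y                         ∎
  where open ≤-Reasoning
... | no ¬lt = ⊥-elim (<⇒≱ x<y (begin
  y                   ≡⟨ m≡m%n+[m/n]*n y q ⟩
  y % q + (y / q) * q ≤⟨ +-mono-≤ (≤-reflexive (sym eq)) (*-monoˡ-≤ q (≮⇒≥ ¬lt)) ⟩
  x % q + (x / q) * q ≡⟨ m≡m%n+[m/n]*n x q ⟨
  x                   ∎))
  where open ≤-Reasoning

close⇒distinct-residues : ∀ q .{{_ : NonZero q}} {x y} → x < y → y < x + q → x % q ≢ y % q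
close⇒distinct-residues q x<y y<x+q eq = <⇒≱ y<x+q (same-residue⇒gap q x<y eq)

same-residue⇒gap-round : ∀ q .{{_ : NonZero q}} k {x y} →
                          y < x + k * q → x % q ≡ y % q → y + q ≤ x + k * q
same-residue⇒gap-round q k {x} y<x+kq x≡y =
  same-residue⇒gap q y<x+kq (trans (sym x≡y) (sym ([m+kn]%n≡m%n x k q)))

ahead⇒% : ∀ {N a b d} .{{_ : NonZero N}} → b < N → Ahead N a b d → (a + d) % N ≡ b
ahead⇒% {N} {a} {b} {d} b<N (ahead j j′ p) = begin
  (a + d) % N         ≡⟨ [m+kn]%n≡m%n (a + d) j N ⟨
  (a + d + j * N) % N ≡⟨ cong (_% N) p ⟩
  (b + j′ * N) % N    ≡⟨ [m+kn]%n≡m%n b j′ N ⟩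
  b % N               ≡⟨ m<n⇒m%n≡m b<N ⟩
  b                   ∎
  where open ≡-Reasoning

ahead-unwind : ∀ {N a b d} .{{_ : NonZero N}} → a < N → b < N → d < N → Ahead N a b d →
  (b ≡ a + d) ⊎ (b + N ≡ a + d)
ahead-unwind {N} {a} {b} {d} a<N b<N d<N a→b with a + d <? N
... | yes a+d<N = inj₁ (trans (sym (ahead⇒% b<N a→b)) (m<n⇒m%n≡m a+d<N))
... | no a+d≮N = inj₂ (begin
  b + N                   ≡⟨ cong (_+ N) (ahead⇒% b<N a→b) ⟨
  (a + d) % N + N         ≡⟨ cong (λ u → u % N + N) (m∸n+n≡m N≤a+d) ⟨
  (a + d ∸ N + N) % N + N ≡⟨ cong (_+ N) ([m+n]%n≡m%n (a + d ∸ N) N) ⟩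
  (a + d ∸ N) % N + N     ≡⟨ cong (_+ N) (m<n⇒m%n≡m a+d∸N<N) ⟩
  a + d ∸ N + N           ≡⟨ m∸n+n≡m N≤a+d ⟩
  a + d                   ∎)
  where
  open ≡-Reasoning
  N≤a+d : N ≤ a + d
  N≤a+d = ≮⇒≥ a+d≮N
  a+d∸N<N : a + d ∸ N < N
  a+d∸N<N = +-cancelʳ-< _ _ N (subst (_< N + N) (sym (m∸n+n≡m N≤a+d)) (+-mono-< a<N d<N))

ahead₀⇒≡ : ∀ {a b d} → Ahead 0 a b d → a + d ≡ b
ahead₀⇒≡ {a} {b} {d} (ahead j j′ p) = begin
  a + d         ≡⟨ +-identityʳ _ ⟨
  a + d + 0     ≡⟨ cong (a + d +_) (*-zeroʳ j) ⟨
  a + d + j * 0 ≡⟨ p ⟩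
  b + j′ * 0    ≡⟨ cong (b +_) (*-zeroʳ j′) ⟩
  b + 0         ≡⟨ +-identityʳ b ⟩
  b             ∎
  where open ≡-Reasoning

quotRem-injective : ∀ n .{{_ : NonZero n}} a b {r s} → r < n → s < n →
  a * n + r ≡ b * n + s → a ≡ b × r ≡ s
quotRem-injective n a b {r} {s} r<n s<n eq = a≡b , r≡s
  where
  open ≡-Reasoning
  r≡s : r ≡ s
  r≡s = begin
    r               ≡⟨ m<n⇒m%n≡m r<n ⟨
    r % n           ≡⟨ [m+kn]%n≡m%n r a n ⟨
    (r + a * n) % n ≡⟨ cong (_% n) (+-comm r (a * n)) ⟩
    (a * n + r) % n ≡⟨ cong (_% n) eq ⟩
    (b * n + s) % n ≡⟨ cong (_% n) (+-comm (b * n) s) ⟩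
    (s + b * n) % n ≡⟨ [m+kn]%n≡m%n s b n ⟩
    s % n           ≡⟨ m<n⇒m%n≡m s<n ⟩
    s               ∎
  a≡b : a ≡ b
  a≡b = *-cancelʳ-≡ a b n (+-cancelʳ-≡ r (a * n) (b * n) (trans eq (cong (b * n +_) (sym r≡s))))

quotRem< : ∀ {a K r n} → a < K → r < n → a * n + r < n * K
quotRem< {a} {K} {r} {n} a<K r<n = begin-strict
  a * n + r <⟨ +-monoʳ-< (a * n) r<n ⟩
  a * n + n ≡⟨ +-comm (a * n) n ⟩
  suc a * n ≤⟨ *-monoˡ-≤ n a<K ⟩
  K * n     ≡⟨ *-comm K n ⟩
  n * K     ∎
  where open ≤-Reasoning

*≤⇒≤/ : ∀ a q N .{{_ : NonZero q}} → a * q ≤ N → a ≤ N / q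
*≤⇒≤/ a q N le = subst (_≤ N / q) (m*n/n≡m a q) (/-monoˡ-≤ q le)

ahead-suc : ∀ M x y → Ahead M (x + y) (x + suc y) 1
ahead-suc M x y = ahead 0 0 (cong (_+ 0) (trans (+-assoc x y 1) (cong (x +_) (+-comm y 1))))

last?-inject₁ : ∀ {n} (j : Fin n) → last? (inject₁ j) ≡ just j
last?-inject₁ {suc n} zero    = refl
last?-inject₁ {suc n} (suc j) = cong (Maybe.map suc) (last?-inject₁ j)

last?-view : ∀ {n} (i : Fin (suc n)) →
  (∃[ k ] last? i ≡ just k × toℕ k ≡ toℕ i) ⊎ (last? i ≡ nothing × toℕ i ≡ n)
last?-view {zero}  zero    = inj₂ (refl , refl)
last?-view {suc n} zero    = inj₁ (zero , refl , refl)
last?-view {suc n} (suc i) with last?-view i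
... | inj₁ (k , eq , k≡i) = inj₁ (suc k , cong (Maybe.map suc) eq , cong suc k≡i)
... | inj₂ (eq , i≡n)     = inj₂ (cong (Maybe.map suc) eq , cong suc i≡n)

cnext-view : ∀ {k} (i : Fin (suc k)) →
  toℕ (cnext i) ≡ suc (toℕ i) ⊎ (toℕ (cnext i) ≡ 0 × suc (toℕ i) ≡ suc k)
cnext-view i with last?-view i
... | inj₁ (_ , eq , k≡i) rewrite eq = inj₁ (cong suc k≡i)
... | inj₂ (eq , i≡k)     rewrite eq = inj₂ (refl , cong suc i≡k)

-- The vertices of G^{1/n}, n = n′ + 1, placed on a line: vertex v of G at (vertexPos v)·n
-- and the internal vertices of edge e at (edgePos e)·n + 1, …, (edgePos e)·n + n′.
module SubdivisionPositions (G : Graph) (n′ : ℕ) (vertexPos : V G → ℕ) (edgePos : Edge G → ℕ) where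
  H : Graph
  H = subdivision′ G n′

  n : ℕ
  n = suc n′

  pos : V H → ℕ
  pos (inj₁ v)       = vertexPos v * n
  pos (inj₂ (e , j)) = edgePos e * n + suc (toℕ j)

  pos-src : ∀ e j → vertexPos (src G e) ≡ edgePos e → pos (src H (e , j)) ≡ edgePos e * n + toℕ j
  pos-src e zero    src≡ = trans (cong (_* n) src≡) (sym (+-identityʳ _))
  pos-src e (suc j) _    rewrite last?-inject₁ j = refl

  tgt-view : ∀ e j → pos (tgt H (e , j)) ≡ edgePos e * n + suc (toℕ j)
                   ⊎ (toℕ j ≡ n′ × tgt H (e , j) ≡ inj₁ (tgt G e))
  tgt-view e j with last?-view j
  ... | inj₁ (_ , eq , k≡j) rewrite eq = inj₁ (cong (λ u → edgePos e * n + suc u) k≡j)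
  ... | inj₂ (eq , j≡n′)    rewrite eq = inj₂ (j≡n′ , refl)

  pos-injective : (∀ {v w} → vertexPos v ≡ vertexPos w → v ≡ w) →
                  (∀ {e f} → edgePos e ≡ edgePos f → e ≡ f) →
                  ∀ {x y} → pos x ≡ pos y → x ≡ y
  pos-injective vinj einj {inj₁ v} {inj₁ w} eq = cong inj₁ (vinj (*-cancelʳ-≡ _ _ n eq))
  pos-injective vinj einj {inj₁ v} {inj₂ (e , j)} eq = ⊥-elim (0≢1+n (proj₂
    (quotRem-injective n (vertexPos v) (edgePos e) (s≤s z≤n) (s≤s (toℕ<n j)) (trans (+-identityʳ _) eq))))
  pos-injective vinj einj {inj₂ (e , j)} {inj₁ v} eq = ⊥-elim (0≢1+n (proj₂
    (quotRem-injective n (vertexPos v) (edgePos e) (s≤s z≤n) (s≤s (toℕ<n j)) (trans (+-identityʳ _) (sym eq)))))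
  pos-injective vinj einj {inj₂ (e , j)} {inj₂ (f , i)} eq
    with quotRem-injective n (edgePos e) (edgePos f) (s≤s (toℕ<n j)) (s≤s (toℕ<n i)) eq
  ... | e≡f , j≡i with einj e≡f | toℕ-injective (suc-injective j≡i)
  ... | refl | refl = refl

  edge-ahead : ∀ M → (∀ e → vertexPos (src G e) ≡ edgePos e) →
               (∀ e → Ahead M (edgePos e * n + n′) (vertexPos (tgt G e) * n) 1) →
               ∀ e → Ahead M (pos (src H e)) (pos (tgt H e)) 1
  edge-ahead M src≡ last-step (e , j) with tgt-view e j
  ... | inj₁ tgt≡ rewrite pos-src e j (src≡ e) | tgt≡ = ahead-suc M (edgePos e * n) (toℕ j)
  ... | inj₂ (j≡n′ , tgt≡) rewrite pos-src e j (src≡ e) | tgt≡ | j≡n′ = last-step e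

[m%n+o]%n≡[m+o]%n : ∀ m n o .{{_ : NonZero n}} → (m % n + o) % n ≡ (m + o) % n
[m%n+o]%n≡[m+o]%n m n o = begin
  (m % n + o) % n         ≡⟨ %-distribˡ-+ (m % n) o n ⟩
  (m % n % n + o % n) % n ≡⟨ cong (λ u → (u + o % n) % n) (m%n%n≡m%n m n) ⟩
  (m % n + o % n) % n     ≡⟨ %-distribˡ-+ m o n ⟨
  (m + o) % n             ∎
  where open ≡-Reasoning

m*[1+n]+n+1≡[1+m]*[1+n] : ∀ m n → m * suc n + n + 1 ≡ suc m * suc n
m*[1+n]+n+1≡[1+m]*[1+n] m n =
  trans (+-assoc (m * suc n) n 1) (trans (cong (m * suc n +_) (+-comm n 1)) (+-comm (m * suc n) (suc n)))

divMod-reconstruct : ∀ {p K n} .{{_ : NonZero K}} .{{_ : NonZero n}} → p < K * n →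
                     toℕ ((p / n) mod K) * n + toℕ (p mod n) ≡ p
divMod-reconstruct {p} {K} {n} p<K*n = begin
  toℕ ((p / n) mod K) * n + toℕ (p mod n) ≡⟨ cong₂ (λ u v → u * n + v)
                                               (toℕ-fromℕ< (m%n<n (p / n) K)) (toℕ-fromℕ< (m%n<n p n)) ⟩
  (p / n) % K * n + p % n                 ≡⟨ cong (λ u → u * n + p % n) (m<n⇒m%n≡m (m<n*o⇒m/o<n p<K*n)) ⟩
  (p / n) * n + p % n                     ≡⟨ +-comm _ (p % n) ⟩
  p % n + (p / n) * n                     ≡⟨ m≡m%n+[m/n]*n p n ⟨
  p                                       ∎
  where open ≡-Reasoning

module CycleSubdivision (k₀ n′ : ℕ) where
  K : ℕ
  K = suc k₀

  open SubdivisionPositions (cycle K) n′ toℕ toℕ public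

  N : ℕ
  N = n * K

  pos-inj : ∀ {x y} → pos x ≡ pos y → x ≡ y
  pos-inj = pos-injective toℕ-injective toℕ-injective

  last-step : ∀ e → Ahead N (toℕ e * n + n′) (toℕ (cnext e) * n) 1
  last-step e with cnext-view {k₀} e
  ... | inj₁ next≡ rewrite next≡ = ahead 0 0 (cong (_+ 0) (m*[1+n]+n+1≡[1+m]*[1+n] (toℕ e) n′))
  ... | inj₂ (next≡ , e+1≡K) rewrite next≡ = ahead 0 1 (begin
    toℕ e * n + n′ + 1 + 0 ≡⟨ +-identityʳ _ ⟩
    toℕ e * n + n′ + 1     ≡⟨ m*[1+n]+n+1≡[1+m]*[1+n] (toℕ e) n′ ⟩
    suc (toℕ e) * n        ≡⟨ cong (_* n) e+1≡K ⟩
    K * n                  ≡⟨ *-comm K n ⟩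
    N                      ≡⟨ +-identityʳ N ⟨
    0 * n + 1 * N          ∎)
    where open ≡-Reasoning

  pos-ahead : ∀ e → Ahead N (pos (src H e)) (pos (tgt H e)) 1
  pos-ahead = edge-ahead N (λ _ → refl) last-step

  pos< : ∀ x → pos x < N
  pos< (inj₁ i)       = subst (_< N) (+-identityʳ _) (quotRem< (toℕ<n i) (s≤s z≤n))
  pos< (inj₂ (e , j)) = quotRem< (toℕ<n e) (s≤s (toℕ<n j))

  edgeAt : ℕ → Edge H
  edgeAt p = (p / n) mod K , p mod n

  vertexAt : ℕ → V H
  vertexAt p = src H (edgeAt p)

  pos-vertexAt : ∀ {p} → p < N → pos (vertexAt p) ≡ p
  pos-vertexAt {p} p<N = trans (pos-src ((p / n) mod K) (p mod n) refl)
    (divMod-reconstruct (subst (p <_) (*-comm n K) p<N))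

  pos-tgt-edgeAt : ∀ {p} → p < N → pos (tgt H (edgeAt p)) ≡ suc p % N
  pos-tgt-edgeAt {p} p<N = sym (begin
    suc p % N                  ≡⟨ cong (_% N) (+-comm 1 p) ⟩
    (p + 1) % N                ≡⟨ cong (λ u → (u + 1) % N) (pos-vertexAt p<N) ⟨
    (pos (vertexAt p) + 1) % N ≡⟨ ahead⇒% (pos< (tgt H (edgeAt p))) (pos-ahead (edgeAt p)) ⟩
    pos (tgt H (edgeAt p))     ∎)
    where open ≡-Reasoning

  walk-forward : ∀ d {a x y} → a < N → pos x ≡ a → pos y ≡ (a + d) % N → Walk H x y d
  walk-forward zero {a} {x} {y} a<N x≡a y≡a
    with refl ← pos-inj {x} {y} (trans x≡a (sym (trans y≡a (trans (cong (_% N) (+-identityʳ a)) (m<n⇒m%n≡m a<N)))))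
    = here
  walk-forward (suc d) {a} {x} {y} a<N x≡a y≡a+d =
    step (edgeAt a , inj₁ (pos-inj (trans (pos-vertexAt a<N) (sym x≡a)) , refl))
         (walk-forward d (m%n<n (suc a) N) (pos-tgt-edgeAt a<N)
            (trans y≡a+d (trans (cong (_% N) (+-suc a d)) (sym ([m%n+o]%n≡[m+o]%n (suc a) N d)))))

module PathSubdivision (k₀ n′ : ℕ) where
  K : ℕ
  K = suc k₀

  open SubdivisionPositions (path (suc K)) n′ toℕ toℕ public

  L : ℕ
  L = K * n

  pos-inj : ∀ {x y} → pos x ≡ pos y → x ≡ y
  pos-inj = pos-injective toℕ-injective toℕ-injective

  pos-ahead : ∀ e → Ahead 0 (pos (src H e)) (pos (tgt H e)) 1
  pos-ahead = edge-ahead 0 toℕ-inject₁ (λ e → ahead 0 0 (cong (_+ 0) (m*[1+n]+n+1≡[1+m]*[1+n] (toℕ e) n′)))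

  pos≤ : ∀ x → pos x ≤ L
  pos≤ (inj₁ i)       = *-monoˡ-≤ n (s≤s⁻¹ (toℕ<n i))
  pos≤ (inj₂ (e , j)) = ≤-trans (<⇒≤ (quotRem< (toℕ<n e) (s≤s (toℕ<n j)))) (≤-reflexive (*-comm n K))

  edgeAt : ℕ → Edge H
  edgeAt p = (p / n) mod K , p mod n

  pos-src-edgeAt : ∀ {p} → p < L → pos (src H (edgeAt p)) ≡ p
  pos-src-edgeAt {p} p<L = trans (pos-src ((p / n) mod K) (p mod n) (toℕ-inject₁ ((p / n) mod K)))
    (divMod-reconstruct p<L)

  pos-tgt-edgeAt : ∀ {p} → p < L → pos (tgt H (edgeAt p)) ≡ suc p
  pos-tgt-edgeAt {p} p<L = begin
    pos (tgt H (edgeAt p))     ≡⟨ ahead₀⇒≡ (pos-ahead (edgeAt p)) ⟨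
    pos (src H (edgeAt p)) + 1 ≡⟨ cong (_+ 1) (pos-src-edgeAt p<L) ⟩
    p + 1                      ≡⟨ +-comm p 1 ⟩
    suc p                      ∎
    where open ≡-Reasoning

  vertexAt : ℕ → V H
  vertexAt zero    = inj₁ zero
  vertexAt (suc p) = tgt H (edgeAt p)

  pos-vertexAt : ∀ {p} → p ≤ L → pos (vertexAt p) ≡ p
  pos-vertexAt {zero}  _   = refl
  pos-vertexAt {suc p} p<L = pos-tgt-edgeAt p<L

  walk-forward : ∀ d {a x y} → a + d ≤ L → pos x ≡ a → pos y ≡ a + d → Walk H x y d
  walk-forward zero {a} {x} {y} _ x≡a y≡a
    with refl ← pos-inj {x} {y} (trans x≡a (sym (trans y≡a (+-identityʳ a)))) = here
  walk-forward (suc d) {a} {x} {y} a+1+d≤L x≡a y≡a+d =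
    step (edgeAt a , inj₁ (pos-inj (trans (pos-src-edgeAt a<L) (sym x≡a)) , refl))
         (walk-forward d (subst (_≤ L) (+-suc a d) a+1+d≤L) (pos-tgt-edgeAt a<L) (trans y≡a+d (+-suc a d)))
    where
    a<L : a < L
    a<L = ≤-<-trans (m≤m+n a d) (subst (_≤ L) (+-suc a d) a+1+d≤L)

CyclicallySeparated : {A : Set} → ℕ → ℕ → (ℕ → A) → Set
CyclicallySeparated N m f =
  ∀ lo hi → lo < hi → hi < N → f lo ≡ f hi → lo + suc m ≤ hi × hi + suc m ≤ lo + N

module _ {A : Set} {N m : ℕ} .{{_ : NonZero N}} {f : ℕ → A}
         (separated : CyclicallySeparated N m f) (m<N : m < N) where

  separated-ahead⇒≢ : ∀ {a b d} → a < N → b < N → a ≢ b → d ≤ m → Ahead N a b d → f a ≢ f b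
  separated-ahead⇒≢ {a} {b} {d} a<N b<N a≢b d≤m a→b fa≡fb
    with ahead-unwind a<N b<N (≤-<-trans d≤m m<N) a→b
  separated-ahead⇒≢ {a} {b} {zero}  _ _ a≢b _ _ _ | inj₁ b≡a+0 = a≢b (sym (trans b≡a+0 (+-identityʳ a)))
  separated-ahead⇒≢ {a} {b} {suc d} _ b<N _ d≤m _ fa≡fb | inj₁ b≡a+1+d =
    <⇒≱ (s≤s d≤m) (+-cancelˡ-≤ a (suc m) (suc d)
      (≤-trans (proj₁ (separated a b a<b b<N fa≡fb)) (≤-reflexive b≡a+1+d)))
    where
    a<b : a < b
    a<b = ≤-trans (s≤s (m≤m+n a d)) (≤-reflexive (trans (sym (+-suc a d)) (sym b≡a+1+d)))
  ... | inj₂ b+N≡a+d =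
    <⇒≱ (s≤s d≤m) (+-cancelˡ-≤ a (suc m) d
      (≤-trans (proj₂ (separated b a b<a a<N (sym fa≡fb))) (≤-reflexive b+N≡a+d)))
    where
    b<a : b < a
    b<a = +-cancelʳ-< N b a (≤-trans (s≤s (≤-reflexive b+N≡a+d)) (+-monoʳ-< a (≤-<-trans d≤m m<N)))

  separated-apart⇒≢ : ∀ {a b d} → a < N → b < N → a ≢ b → d ≤ m → Apart N a b d → f a ≢ f b
  separated-apart⇒≢ a<N b<N a≢b d≤m (inj₁ a→b) = separated-ahead⇒≢ a<N b<N a≢b d≤m a→b
  separated-apart⇒≢ a<N b<N a≢b d≤m (inj₂ b→a) = separated-ahead⇒≢ b<N a<N (≢-sym a≢b) d≤m b→a ∘ sym

[1+k]*n+f≡k*n+f+n : ∀ k n f → suc k * n + f ≡ k * n + f + n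
[1+k]*n+f≡k*n+f+n = solve-∀

module ColourClasses {r : ℕ} (N m : ℕ) (g : ℕ → Fin r) (separated : CyclicallySeparated N m g)
                     (m<N : m < N) where

  occurrences : Fin r → ℕ → ℕ
  occurrences c zero = 0
  occurrences c (suc x) with g x Fin.≟ c
  ... | yes _ = suc (occurrences c x)
  ... | no _  = occurrences c x

  occurrences-suc : ∀ c x → occurrences c x ≤ occurrences c (suc x)
  occurrences-suc c x with g x Fin.≟ c
  ... | yes _ = n≤1+n _
  ... | no _  = ≤-refl

  occurrences-mono : ∀ c {x y} → x ≤ y → occurrences c x ≤ occurrences c y
  occurrences-mono c {x} {y} x≤y with k , refl ← m≤n⇒∃[o]m+o≡n x≤y = go k
    where
    go : ∀ k → occurrences c x ≤ occurrences c (x + k)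
    go zero    = ≤-reflexive (cong (occurrences c) (sym (+-identityʳ x)))
    go (suc k) = ≤-trans (go k) (subst (λ u → occurrences c (x + k) ≤ occurrences c u) (sym (+-suc x k))
                   (occurrences-suc c (x + k)))

  occurrences-own : ∀ x → occurrences (g x) (suc x) ≡ suc (occurrences (g x) x)
  occurrences-own x with g x Fin.≟ g x
  ... | yes _ = refl
  ... | no gx≢gx = ⊥-elim (gx≢gx refl)

  -- The first and last occurrences of c before y; at least k (m + 1) apart once c occurs k + 1 times.
  record Spread (c : Fin r) (y k : ℕ) : Set where
    field
      first last : ℕ
      first≤last : first ≤ last
      last<y     : last < y
      g-first    : g first ≡ c
      g-last     : g last ≡ c
      spaced     : k * suc m + first ≤ last

  spread-suc : ∀ {c y k} → Spread c y k → Spread c (suc y) k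
  spread-suc s = record { Spread s ; last<y = m<n⇒m<1+n (Spread.last<y s) }

  spread : ∀ c y → y ≤ N → occurrences c y ≡ 0 ⊎ ∃[ k ] occurrences c y ≡ suc k × Spread c y k
  spread c zero    _ = inj₁ refl
  spread c (suc y) y<N with g y Fin.≟ c | spread c y (<⇒≤ y<N)
  ... | no _   | inj₁ none = inj₁ none
  ... | no _   | inj₂ (k , count , s) = inj₂ (k , count , spread-suc s)
  ... | yes gy | inj₁ none = inj₂ (0 , cong suc none , record
    { first = y ; last = y ; first≤last = ≤-refl ; last<y = n<1+n y
    ; g-first = gy ; g-last = gy ; spaced = ≤-refl })
  ... | yes gy | inj₂ (k , count , s) = inj₂ (suc k , cong suc count , record
    { first = first ; last = y ; first≤last = ≤-trans first≤last (<⇒≤ last<y) ; last<y = n<1+n y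
    ; g-first = g-first ; g-last = gy ; spaced = spaced′ })
    where
    open Spread s
    spaced′ : suc k * suc m + first ≤ y
    spaced′ = begin
      suc k * suc m + first     ≡⟨ [1+k]*n+f≡k*n+f+n k (suc m) first ⟩
      k * suc m + first + suc m ≤⟨ +-monoˡ-≤ (suc m) spaced ⟩
      last + suc m              ≤⟨ proj₁ (separated last y last<y y<N (trans g-last (sym gy))) ⟩
      y                         ∎
      where open ≤-Reasoning

  occurrences-bound : ∀ c y → y ≤ N → occurrences c y * suc m ≤ N
  occurrences-bound c y y≤N with spread c y y≤N
  ... | inj₁ none rewrite none = z≤n
  ... | inj₂ (k , count , s) rewrite count = +-cancelʳ-≤ first (suc k * suc m) N (begin
    suc k * suc m + first     ≡⟨ [1+k]*n+f≡k*n+f+n k (suc m) first ⟩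
    k * suc m + first + suc m ≤⟨ +-monoˡ-≤ (suc m) spaced ⟩
    last + suc m              ≤⟨ wraps-round (m≤n⇒m<n∨m≡n first≤last) ⟩
    first + N                 ≡⟨ +-comm first N ⟩
    N + first                 ∎)
    where
    open Spread s
    open ≤-Reasoning
    wraps-round : first < last ⊎ first ≡ last → last + suc m ≤ first + N
    wraps-round (inj₁ first<last) =
      proj₂ (separated first last first<last (<-≤-trans last<y y≤N) (trans g-first (sym g-last)))
    wraps-round (inj₂ refl)       = +-monoʳ-≤ first m<N

  rank : ℕ → ℕ
  rank x = occurrences (g x) x

  rank< : ∀ {x} → x < N → rank x < N / suc m
  rank< {x} x<N = subst (_≤ N / suc m) (occurrences-own x)
    (*≤⇒≤/ (occurrences (g x) (suc x)) (suc m) N (occurrences-bound (g x) (suc x) x<N))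

  rank-increasing : ∀ {x y} → x < y → g x ≡ g y → rank x < rank y
  rank-increasing {x} {y} x<y gx≡gy = begin-strict
    rank x                     <⟨ n<1+n (rank x) ⟩
    suc (rank x)               ≡⟨ occurrences-own x ⟨
    occurrences (g x) (suc x)  ≡⟨ cong (λ c → occurrences c (suc x)) gx≡gy ⟩
    occurrences (g y) (suc x)  ≤⟨ occurrences-mono (g y) x<y ⟩
    rank y                     ∎
    where open ≤-Reasoning

  -- x ↦ (g x, rank x) is injective on [0, N).
  N≤colours*classSize : N ≤ r * (N / suc m)
  N≤colours*classSize with r * (N / suc m) <? N
  ... | no ≮N = ≮⇒≥ ≮N
  ... | yes <N with pigeonhole <N (λ i → combine (g (toℕ i)) (fromℕ< (rank< (toℕ<n i))))
  ... | i , j , i<j , same with combine-injective _ _ _ _ same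
  ... | gi≡gj , ranki≡rankj = ⊥-elim (<-irrefl rank-i≡rank-j (rank-increasing i<j gi≡gj))
    where
    rank-i≡rank-j : rank (toℕ i) ≡ rank (toℕ j)
    rank-i≡rank-j = fromℕ<-injective (rank< (toℕ<n i)) (rank< (toℕ<n j)) ranki≡rankj

≤*⇒ceilDiv≤ : ∀ N t r → 1 ≤ t → N ≤ r * t → ceilDiv N t ≤ r
≤*⇒ceilDiv≤ N (suc t′) r _ N≤r*t = s≤s⁻¹ (m<n*o⇒m/o<n (begin-strict
  N + t′               ≤⟨ +-monoˡ-≤ t′ N≤r*t ⟩
  r * suc t′ + t′      <⟨ +-monoʳ-< (r * suc t′) (n<1+n t′) ⟩
  r * suc t′ + suc t′  ≡⟨ +-comm (r * suc t′) (suc t′) ⟩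
  suc r * suc t′       ∎))
  where open ≤-Reasoning

-- ℤ/(L + E), L = s q and E = e q₁, cut into s blocks of length q followed by e blocks of
-- length q₁; colour each position by its offset inside its block.
module TwoBlockColouring (m q₁ s e : ℕ) .{{_ : NonZero q₁}}
                         (m≤q₁ : m ≤ q₁) (m<q₁ : 0 < e * q₁ → m < q₁) where
  q L E N : ℕ
  q = suc q₁
  L = s * q
  E = e * q₁
  N = L + E

  offset : ℕ → ℕ
  offset p with p <? L
  ... | yes _ = p % q
  ... | no _  = (p ∸ L) % q₁

  offset-head : ∀ {p} → p < L → offset p ≡ p % q
  offset-head {p} p<L with p <? L
  ... | yes _   = refl
  ... | no p≮L = ⊥-elim (p≮L p<L)

  offset-tail : ∀ u → offset (L + u) ≡ u % q₁
  offset-tail u with L + u <? L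
  ... | yes L+u<L = ⊥-elim (m+n≮m L u L+u<L)
  ... | no _      = cong (_% q₁) (m+n∸m≡n L u)

  offset< : ∀ p → offset p < q
  offset< p with p <? L
  ... | yes _ = m%n<n p q
  ... | no _  = m<n⇒m<1+n (m%n<n (p ∸ L) q₁)

  head-head : ∀ {lo hi} → lo < hi → hi < L → lo % q ≡ hi % q →
              lo + suc m ≤ hi × hi + suc m ≤ lo + N
  head-head {lo} {hi} lo<hi hi<L same =
      ≤-trans (+-monoʳ-≤ lo (s≤s m≤q₁)) (same-residue⇒gap q lo<hi same)
    , (begin
      hi + suc m ≤⟨ +-monoʳ-≤ hi (s≤s m≤q₁) ⟩
      hi + q     ≤⟨ same-residue⇒gap-round q s (<-≤-trans hi<L (m≤n+m L lo)) same ⟩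
      lo + L     ≤⟨ +-monoʳ-≤ lo (m≤m+n L E) ⟩
      lo + N     ∎)
    where open ≤-Reasoning

  tail-tail : ∀ {u v} → u < v → v < E → u % q₁ ≡ v % q₁ →
              L + u + suc m ≤ L + v × L + v + suc m ≤ L + u + N
  tail-tail {u} {v} u<v v<E same =
      (begin
      L + u + suc m   ≡⟨ +-assoc L u (suc m) ⟩
      L + (u + suc m) ≤⟨ +-monoʳ-≤ L (+-monoʳ-≤ u (m<q₁ (≤-<-trans z≤n v<E))) ⟩
      L + (u + q₁)    ≤⟨ +-monoʳ-≤ L (same-residue⇒gap q₁ u<v same) ⟩
      L + v           ∎)
    , (begin
      L + v + suc m   ≡⟨ +-assoc L v (suc m) ⟩
      L + (v + suc m) ≤⟨ +-monoʳ-≤ L (+-monoʳ-≤ v (m<q₁ (≤-<-trans z≤n v<E))) ⟩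
      L + (v + q₁)    ≤⟨ +-monoʳ-≤ L (same-residue⇒gap-round q₁ e (<-≤-trans v<E (m≤n+m E u)) same) ⟩
      L + (u + E)     ≡⟨ +-assoc L u E ⟨
      L + u + E       ≤⟨ +-monoʳ-≤ (L + u) (m≤n+m E L) ⟩
      L + u + N       ∎)
    where open ≤-Reasoning

  head-tail : ∀ {lo v} → lo < L → v < E → lo % q ≡ v % q₁ →
              lo + suc m ≤ L + v × L + v + suc m ≤ lo + N
  head-tail {lo} {v} lo<L v<E same =
      (begin
      lo + suc m ≤⟨ +-monoʳ-≤ lo (s≤s m≤q₁) ⟩
      lo + q     ≤⟨ same-residue⇒gap q (<-≤-trans lo<L (m≤n+m L i)) (sym i+L≡lo) ⟩
      i + L      ≤⟨ +-monoˡ-≤ L i≤v ⟩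
      v + L      ≡⟨ +-comm v L ⟩
      L + v      ∎)
    , (begin
      L + v + suc m   ≡⟨ +-assoc L v (suc m) ⟩
      L + (v + suc m) ≤⟨ +-monoʳ-≤ L (+-monoʳ-≤ v (m<q₁ (≤-<-trans z≤n v<E))) ⟩
      L + (v + q₁)    ≤⟨ +-monoʳ-≤ L (same-residue⇒gap-round q₁ e (<-≤-trans v<E (m≤n+m E i)) i≡v) ⟩
      L + (i + E)     ≤⟨ +-monoʳ-≤ L (+-monoˡ-≤ E (m%n≤m lo q)) ⟩
      L + (lo + E)    ≡⟨ x∙yz≈y∙xz L lo E ⟩
      lo + N          ∎)
    where
    open ≤-Reasoning
    i : ℕ
    i = lo % q
    i+L≡lo : (i + L) % q ≡ lo % q
    i+L≡lo = trans ([m+kn]%n≡m%n i s q) (m%n%n≡m%n lo q)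
    i≤v : i ≤ v
    i≤v = subst (_≤ v) (sym same) (m%n≤m v q₁)
    i≡v : i % q₁ ≡ v % q₁
    i≡v = trans (cong (_% q₁) same) (m%n%n≡m%n v q₁)

  offset-separated : CyclicallySeparated N m offset
  offset-separated lo hi lo<hi hi<N same with <-≤-connex lo L | <-≤-connex hi L
  ... | inj₁ lo<L | inj₁ hi<L =
    head-head lo<hi hi<L (trans (sym (offset-head lo<L)) (trans same (offset-head hi<L)))
  ... | inj₂ L≤lo | inj₁ hi<L = ⊥-elim (<⇒≱ (<-trans lo<hi hi<L) L≤lo)
  ... | inj₁ lo<L | inj₂ L≤hi with v , refl ← m≤n⇒∃[o]m+o≡n L≤hi =
    head-tail lo<L (+-cancelˡ-< L v E hi<N) (trans (sym (offset-head lo<L)) (trans same (offset-tail v)))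
  ... | inj₂ L≤lo | inj₂ L≤hi with u , refl ← m≤n⇒∃[o]m+o≡n L≤lo
                               | v , refl ← m≤n⇒∃[o]m+o≡n L≤hi =
    tail-tail (+-cancelˡ-< L u v lo<hi) (+-cancelˡ-< L v E hi<N) (trans (sym (offset-tail u)) (trans same (offset-tail v)))

  colour : ℕ → Fin q
  colour p = fromℕ< (offset< p)

  colour-separated : CyclicallySeparated N m colour
  colour-separated lo hi lo<hi hi<N same =
    offset-separated lo hi lo<hi hi<N (fromℕ<-injective (offset< lo) (offset< hi) same)

[1+a]*[b+c]≡b*[1+a]+c*a+c : ∀ a b c → suc a * (b + c) ≡ b * suc a + c * a + c
[1+a]*[b+c]≡b*[1+a]+c*a+c = solve-∀

-- With q = ⌈N/t⌉ and e = q t − N ≤ t one has N = (t − e) q + e (q − 1).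
module CeilDecomposition (N m t′ : ℕ) (t*[m+1]≤N : suc t′ * suc m ≤ N) (1≤m : 1 ≤ m) where
  t q : ℕ
  t = suc t′
  q = ceilDiv N t

  q*t≤N+t′ : q * t ≤ N + t′
  q*t≤N+t′ = m/n*n≤m (N + t′) t

  N≤q*t : N ≤ q * t
  N≤q*t = +-cancelʳ-≤ t′ N (q * t) (s≤s⁻¹ (begin-strict
    N + t′                 ≡⟨ m≡m%n+[m/n]*n (N + t′) t ⟩
    (N + t′) % t + q * t   <⟨ +-monoˡ-< (q * t) (m%n<n (N + t′) t) ⟩
    t + q * t              ≡⟨ +-comm t (q * t) ⟩
    q * t + suc t′         ≡⟨ +-suc (q * t) t′ ⟩
    suc (q * t + t′)       ∎))
    where open ≤-Reasoning

  m<q : m < q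
  m<q = *-cancelʳ-≤ (suc m) q t (≤-trans (≤-reflexive (*-comm (suc m) t)) (≤-trans t*[m+1]≤N N≤q*t))

  instance
    q-nonZero : NonZero q
    q-nonZero = >-nonZero (≤-<-trans z≤n m<q)

  q₁ e s : ℕ
  q₁ = pred q
  e  = q * t ∸ N
  s  = t ∸ e

  q≡1+q₁ : q ≡ suc q₁
  q≡1+q₁ = sym (suc-pred q)

  m≤q₁ : m ≤ q₁
  m≤q₁ = s≤s⁻¹ (subst (m <_) q≡1+q₁ m<q)

  instance
    q₁-nonZero : NonZero q₁
    q₁-nonZero = >-nonZero (≤-trans 1≤m m≤q₁)

  e≤t : e ≤ t
  e≤t = ≤-trans (∸-monoˡ-≤ N q*t≤N+t′) (≤-trans (≤-reflexive (m+n∸m≡n N t′)) (n≤1+n t′))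

  N≡s*q+e*q₁ : N ≡ s * suc q₁ + e * q₁
  N≡s*q+e*q₁ = +-cancelʳ-≡ e N (s * suc q₁ + e * q₁) (begin
    N + e                      ≡⟨ m+[n∸m]≡n N≤q*t ⟩
    q * t                      ≡⟨ cong₂ _*_ q≡1+q₁ (sym (m∸n+n≡m e≤t)) ⟩
    suc q₁ * (s + e)           ≡⟨ [1+a]*[b+c]≡b*[1+a]+c*a+c q₁ s e ⟩
    s * suc q₁ + e * q₁ + e    ∎)
    where open ≡-Reasoning

  -- If q = m + 1 then q t ≤ N, so e = 0 and there are no blocks of length q₁.
  m<q₁ : 0 < e * q₁ → m < q₁
  m<q₁ 0<e*q₁ with m <? q₁
  ... | yes m<q₁ = m<q₁
  ... | no m≮q₁  = ⊥-elim (n≮n 0 (subst (λ x → 0 < x * q₁) e≡0 0<e*q₁))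
    where
    q*t≤N : q * t ≤ N
    q*t≤N = begin
      q * t     ≤⟨ *-monoˡ-≤ t (subst (_≤ suc m) (sym q≡1+q₁) (s≤s (≮⇒≥ m≮q₁))) ⟩
      suc m * t ≡⟨ *-comm (suc m) t ⟩
      t * suc m ≤⟨ t*[m+1]≤N ⟩
      N         ∎
      where open ≤-Reasoning
    e≡0 : e ≡ 0
    e≡0 = m≤n⇒m∸n≡0 q*t≤N

  open TwoBlockColouring m q₁ s e m≤q₁ m<q₁ using (colour; colour-separated)

  separated-colouring : ∃[ f ] CyclicallySeparated {Fin q} N m f
  separated-colouring = subst (λ Q → ∃[ f ] CyclicallySeparated {Fin Q} N m f) (sym q≡1+q₁)
    (colour , subst (λ N′ → CyclicallySeparated N′ m colour) (sym N≡s*q+e*q₁) colour-separated)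

separated-colouring : ∀ N m → 1 ≤ m → m < N →
  ∃[ f ] CyclicallySeparated {Fin (ceilDiv N (N / suc m))} N m f
separated-colouring N m 1≤m m<N with N / suc m in t≡
... | zero   = ⊥-elim (n≮n 0 (subst (0 <_) t≡ (*≤⇒≤/ 1 (suc m) N (subst (_≤ N) (sym (*-identityˡ (suc m))) m<N))))
... | suc t′ = CeilDecomposition.separated-colouring N m t′
                 (subst (λ t → t * suc m ≤ N) t≡ (m/n*n≤m N (suc m))) 1≤m

gap-or-close : ∀ m a b → a + suc m ≤ b ⊎ b ∸ a ≤ m
gap-or-close m a b with a + suc m ≤? b
... | yes gap   = inj₁ gap
... | no no-gap = inj₂ (s≤s⁻¹ (m<n+o⇒m∸n<o b a (≰⇒> no-gap)))

m<n⇒0<n/[1+m] : ∀ {m n} → m < n → 0 < n / suc m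
m<n⇒0<n/[1+m] {m} {n} m<n = *≤⇒≤/ 1 (suc m) n (subst (_≤ n) (sym (*-identityˡ (suc m))) m<n)

separated⇒2m<N : ∀ {A : Set} {N m lo hi} {f : ℕ → A} → CyclicallySeparated N m f →
                 lo < hi → hi < N → f lo ≡ f hi → 2 * m < N
separated⇒2m<N {N = N} {m} {lo} {hi} separated lo<hi hi<N same = +-cancelˡ-< lo (2 * m) N (begin-strict
  lo + 2 * m             ≡⟨ cong (λ u → lo + (m + u)) (+-identityʳ m) ⟩
  lo + (m + m)           <⟨ +-monoʳ-< lo (+-monoʳ-< m (n<1+n m)) ⟩
  lo + (m + suc m)       ≤⟨ +-monoʳ-≤ lo (+-monoˡ-≤ (suc m) (n≤1+n m)) ⟩
  lo + (suc m + suc m)   ≡⟨ +-assoc lo (suc m) (suc m) ⟨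
  lo + suc m + suc m     ≤⟨ +-monoˡ-≤ (suc m) lo+m<hi ⟩
  hi + suc m             ≤⟨ hi+m<lo+N ⟩
  lo + N                 ∎)
  where
  open ≤-Reasoning
  lo+m<hi = proj₁ (separated lo hi lo<hi hi<N same)
  hi+m<lo+N = proj₂ (separated lo hi lo<hi hi<N same)

module CyclePower (k₀ n′ m : ℕ) where
  open CycleSubdivision k₀ n′
  open ApartAlongWalks H N pos pos-ahead

  vertexAt-injective : ∀ {a b} → a < N → b < N → vertexAt a ≡ vertexAt b → a ≡ b
  vertexAt-injective a<N b<N eq = trans (sym (pos-vertexAt a<N)) (trans (cong pos eq) (pos-vertexAt b<N))

  forward-edge : ∀ {a b d} → a < N → b < N → a ≢ b → d ≤ m → (a + d) % N ≡ b → Edge (power H m)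
  forward-edge {a} {b} {d} a<N b<N a≢b d≤m a+d≡b =
    vertexAt a , vertexAt b , a≢b ∘ vertexAt-injective a<N b<N , d , d≤m ,
    walk-forward d a<N (pos-vertexAt a<N) (trans (pos-vertexAt b<N) (sym a+d≡b))

  colouring⇒separated : ∀ {r} (col : Colorable (power H m) r) → CyclicallySeparated N m (proj₁ col ∘ vertexAt)
  colouring⇒separated (c , proper) lo hi lo<hi hi<N same = lo+m<hi , hi+m<lo+N
    where
    lo<N : lo < N
    lo<N = <-trans lo<hi hi<N
    lo+m<hi : lo + suc m ≤ hi
    lo+m<hi with gap-or-close m lo hi
    ... | inj₁ gap   = gap
    ... | inj₂ close = ⊥-elim (proper (forward-edge lo<N hi<N (<⇒≢ lo<hi) close
      (trans (cong (_% N) (m+[n∸m]≡n (<⇒≤ lo<hi))) (m<n⇒m%n≡m hi<N))) same)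
    hi+m<lo+N : hi + suc m ≤ lo + N
    hi+m<lo+N with gap-or-close m hi (lo + N)
    ... | inj₁ gap   = gap
    ... | inj₂ close = ⊥-elim (proper (forward-edge hi<N lo<N (≢-sym (<⇒≢ lo<hi)) close
      (trans (cong (_% N) (m+[n∸m]≡n hi≤lo+N)) (trans ([m+n]%n≡m%n lo N) (m<n⇒m%n≡m lo<N)))) (sym same))
      where
      hi≤lo+N : hi ≤ lo + N
      hi≤lo+N = ≤-trans (<⇒≤ hi<N) (m≤n+m N lo)

  separated⇒colouring : ∀ {r} (f : ℕ → Fin r) → CyclicallySeparated N m f → m < N → Colorable (power H m) r
  separated⇒colouring f separated m<N = f ∘ pos , proper
    where
    proper : ∀ (e : Edge (power H m)) → f (pos (src (power H m) e)) ≢ f (pos (tgt (power H m) e))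
    proper (x , y , x≢y , ℓ , ℓ≤m , w) with walk⇒apart w
    ... | d , d≤ℓ , apart =
      separated-apart⇒≢ separated m<N (pos< x) (pos< y) (x≢y ∘ pos-inj) (≤-trans d≤ℓ ℓ≤m) apart

  χ-large-m : N ≤ 2 * m → ChromaticNumber (power H m) N
  χ-large-m N≤2m = (colour , proper) , at-least-N
    where
    colour : V H → Fin N
    colour x = fromℕ< (pos< x)
    proper : ∀ (e : Edge (power H m)) → colour (src (power H m) e) ≢ colour (tgt (power H m) e)
    proper (x , y , x≢y , _) same = x≢y (pos-inj (fromℕ<-injective (pos< x) (pos< y) same))
    at-least-N : ∀ r → Colorable (power H m) r → N ≤ r
    at-least-N r col with r <? N
    ... | no r≮N = ≮⇒≥ r≮N
    ... | yes r<N with pigeonhole r<N (proj₁ col ∘ vertexAt ∘ toℕ)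
    ... | i , j , i<j , same = ⊥-elim (<⇒≱ (separated⇒2m<N (colouring⇒separated col) i<j (toℕ<n j) same) N≤2m)

  χ-small-m : 1 ≤ m → 2 * m < N → ChromaticNumber (power H m) (ceilDiv N (N / suc m))
  χ-small-m 1≤m 2m<N = separated⇒colouring colour separated m<N , at-least
    where
    m<N : m < N
    m<N = ≤-<-trans (m≤m+n m (m + 0)) 2m<N
    colour = proj₁ (separated-colouring N m 1≤m m<N)
    separated = proj₂ (separated-colouring N m 1≤m m<N)
    at-least : ∀ r → Colorable (power H m) r → ceilDiv N (N / suc m) ≤ r
    at-least r col = ≤*⇒ceilDiv≤ N (N / suc m) r (m<n⇒0<n/[1+m] m<N)
      (ColourClasses.N≤colours*classSize N m (proj₁ col ∘ vertexAt) (colouring⇒separated col) m<N)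

module PathPower (k₀ n′ m : ℕ) where
  open PathSubdivision k₀ n′
  open ApartAlongWalks H 0 pos pos-ahead

  Q : ℕ
  Q = (m + 1) ⊓ (L + 1)

  instance
    Q-nonZero : NonZero Q
    Q-nonZero = >-nonZero (⊓-glb (m≤n+m 1 m) (m≤n+m 1 L))

  ≤⇒<Q : ∀ {d} → d ≤ m → d ≤ L → d < Q
  ≤⇒<Q {d} d≤m d≤L = ⊓-glb (≤⇒<+1 d≤m) (≤⇒<+1 d≤L)
    where
    ≤⇒<+1 : ∀ {x y} → x ≤ y → x < y + 1
    ≤⇒<+1 {x} {y} x≤y = subst (x <_) (+-comm 1 y) (s≤s x≤y)

  residues-differ : ∀ {a b d} → a ≢ b → d ≤ m → a + d ≡ b → b ≤ L → a % Q ≢ b % Q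
  residues-differ {a} {d = zero}  a≢b _   a+0≡b _ = ⊥-elim (a≢b (trans (sym (+-identityʳ a)) a+0≡b))
  residues-differ {a} {d = suc d} _   1+d≤m refl b≤L =
    close⇒distinct-residues Q (m<m+n a z<s) (+-monoʳ-< a (≤⇒<Q 1+d≤m (m+n≤o⇒n≤o a b≤L)))

  colour : V H → Fin Q
  colour x = pos x mod Q

  proper : ∀ (e : Edge (power H m)) → colour (src (power H m) e) ≢ colour (tgt (power H m) e)
  proper (x , y , x≢y , ℓ , ℓ≤m , w) same with walk⇒apart w
  ... | d , d≤ℓ , inj₁ x→y =
    residues-differ (x≢y ∘ pos-inj) (≤-trans d≤ℓ ℓ≤m) (ahead₀⇒≡ x→y) (pos≤ y)
      (fromℕ<-injective (m%n<n (pos x) Q) (m%n<n (pos y) Q) same)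
  ... | d , d≤ℓ , inj₂ y→x =
    residues-differ (x≢y ∘ sym ∘ pos-inj) (≤-trans d≤ℓ ℓ≤m) (ahead₀⇒≡ y→x) (pos≤ x)
      (sym (fromℕ<-injective (m%n<n (pos x) Q) (m%n<n (pos y) Q) same))

  -- The vertices at positions 0, …, Q − 1 are pairwise adjacent.
  at-least-Q : ∀ r → Colorable (power H m) r → Q ≤ r
  at-least-Q r (c , proper′) with r <? Q
  ... | no r≮Q = ≮⇒≥ r≮Q
  ... | yes r<Q with pigeonhole r<Q (c ∘ vertexAt ∘ toℕ)
  ... | i , j , i<j , same =
    ⊥-elim (proper′ (vertexAt (toℕ i) , vertexAt (toℕ j) , i≢j , toℕ j ∸ toℕ i , j-i≤m , walk) same)
    where
    j<Q : toℕ j < Q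
    j<Q = toℕ<n j
    j≤L : toℕ j ≤ L
    j≤L = s≤s⁻¹ (subst (toℕ j <_) (+-comm L 1) (<-≤-trans j<Q (m⊓n≤n (m + 1) (L + 1))))
    i≤L : toℕ i ≤ L
    i≤L = ≤-trans (<⇒≤ i<j) j≤L
    i≢j : vertexAt (toℕ i) ≢ vertexAt (toℕ j)
    i≢j eq = <⇒≢ i<j (trans (sym (pos-vertexAt i≤L)) (trans (cong pos eq) (pos-vertexAt j≤L)))
    j-i≤m : toℕ j ∸ toℕ i ≤ m
    j-i≤m = ≤-trans (m∸n≤m (toℕ j) (toℕ i))
      (s≤s⁻¹ (subst (toℕ j <_) (+-comm m 1) (<-≤-trans j<Q (m⊓n≤m (m + 1) (L + 1)))))
    i+[j-i]≡j : toℕ i + (toℕ j ∸ toℕ i) ≡ toℕ j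
    i+[j-i]≡j = m+[n∸m]≡n (<⇒≤ i<j)
    walk : Walk H (vertexAt (toℕ i)) (vertexAt (toℕ j)) (toℕ j ∸ toℕ i)
    walk = walk-forward (toℕ j ∸ toℕ i) (subst (_≤ L) (sym i+[j-i]≡j) j≤L)
             (pos-vertexAt i≤L) (trans (pos-vertexAt j≤L) (sym i+[j-i]≡j))

  χ : ChromaticNumber (power H m) Q
  χ = (colour , proper) , at-least-Q

corollary1 : (m n k : ℕ) → 1 ≤ m → 1 ≤ n → 3 ≤ k →
    ((n * k ≤ 2 * m → ChromaticNumber (fracPower (cycle k) m n) (n * k))
      × (2 * m < n * k → ChromaticNumber (fracPower (cycle k) m n) (ceilDiv (n * k) ((n * k) / suc m))))
    × ChromaticNumber (fracPower (path k) m n) ((m + 1) ⊓ ((k ∸ 1) * n + 1))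
corollary1 m (suc n′) (suc (suc (suc k₀))) 1≤m _ _ =
  (CyclePower.χ-large-m (suc (suc k₀)) n′ m , CyclePower.χ-small-m (suc (suc k₀)) n′ m 1≤m) ,
  PathPower.χ (suc k₀) n′ m
corollary1 m (suc n′) 1 _ _ (s≤s ())
corollary1 m (suc n′) 2 _ _ (s≤s (s≤s ()))
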